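{- Let $F:\mathbb{F}_{2^n}\to\mathbb{F}_{2^n}$ be a function. The set $S=\{(x,F(x)) : x\in\mathbb{F}_{2^n}\}\subset\mathbb{F}_{2^n}^2$ is formally self dual under the trace pairing if and only if $2^n\delta_F(a,b)=(W_F(a,b))^2$ for all $a,b\in\mathbb{F}_{2^n}$.
   Context: $\mathrm{Tr}:\mathbb{F}_{2^n}\to\mathbb{F}_2$ is the absolute trace $x\mapsto x+x^2+\dots+x^{2^{n-1}}$. $\delta_F(a,b)=|\{x\in\mathbb{F}_{2^n}:F(x+a)+F(x)=b\}|$ and $W_F(a,b)=\sum_{x\in\mathbb{F}_{2^n}}(-1)^{\mathrm{Tr}(bF(x)+ax)}$. Let $G=\mathbb{F}_{2^n}^2$ (additive group) and $\Delta:G\to\hat G$ the isomorphism given by the trace pairing $\langle (x,y),(a,b)\rangle=(-1)^{\mathrm{Tr}(ax+by)}$, i.e. $[\Delta(a,b)](x,y)=(-1)^{\mathrm{Tr}(ax+by)}$. $S\subset G$ is formally self dual under the trace pairing if $S$ and $\Delta(S)$ form a formally dual pair, meaning $|\chi(S)|^2=\frac{|S|^2}{|\Delta(S)|}\nu_{\Delta(S)}(\chi)$ for all $\chi\in\hat G$ with $\chi(S)=\sum_{s\in S}\chi(s)$, $\nu_T(\chi)=|\{(\phi,\psi)\in T^2:\phi\psi^{ -1}=\chi\}|$; equivalently, for all $(a,b)\in G$: $\big(\sum_{(x,y)\in S}(-1)^{\mathrm{Tr}(ax+by)}\big)^2=|S|\cdot|\{(s,t)\in S^2:s-t=(a,b)\}|$.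 -}

module Defs where

open import Data.Nat as ℕ using (ℕ; zero; suc)
open import Data.Integer as ℤ using (ℤ)
open import Data.Fin using (Fin)
open import Data.Bool using (Bool; true; false; if_then_else_; _∧_)
open import Data.Product using (∃; _,_)
open import Relation.Nullary using (¬_)
open import Relation.Nullary.Decidable using (⌊_⌋)
open import Relation.Binary.PropositionalEquality using (_≡_; _≢_)
open import Relation.Binary.Definitions using (DecidableEquality)
open import Algebra.Structures using (IsCommutativeRing)
open import Function.Bundles using (_↔_; Inverse)

-- A finite field with exactly 2^n elements, i.e. (a model of) 𝔽_{2^n}.
record GF (n : ℕ) : Set₁ where
  infixl 6 _+_ _-_
  infixl 7 _*_
  infix 4 _≟_
  field
    Carrier : Set
    _+_ _*_ : Carrier → Carrier → Carrier
    -_      : Carrier → Carrier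
    0# 1#   : Carrier
    isCommutativeRing : IsCommutativeRing _≡_ _+_ _*_ -_ 0# 1#
    0≢1     : 0# ≢ 1#
    inverse : ∀ x → x ≢ 0# → ∃ λ y → x * y ≡ 1#
    _≟_     : DecidableEquality Carrier
    enum    : Fin (2 ℕ.^ n) ↔ Carrier

  _-_ : Carrier → Carrier → Carrier
  x - y = x + (- y)

  sumFin : (k : ℕ) → (Fin k → ℤ) → ℤ
  sumFin zero    f = ℤ.0ℤ
  sumFin (suc k) f = f Fin.zero ℤ.+ sumFin k (λ i → f (Fin.suc i))
    where import Data.Fin as Fin

  Σ[x] : (Carrier → ℤ) → ℤ
  Σ[x] f = sumFin (2 ℕ.^ n) (λ i → f (Inverse.to enum i))

  pow : Carrier → ℕ → Carrier
  pow x zero    = 1#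
  pow x (suc m) = x * pow x m

  Tr : Carrier → Carrier
  Tr x = go n
    where
    go : ℕ → Carrier
    go zero    = 0#
    go (suc i) = pow x (2 ℕ.^ i) + go i

  -- (-1)^{Tr(x)} ; Tr(x) ∈ 𝔽₂ = {0,1}
  sgn : Carrier → ℤ
  sgn x = if ⌊ Tr x ≟ 0# ⌋ then ℤ.1ℤ else ℤ.-1ℤ

  [_] : Bool → ℤ
  [ b ] = if b then ℤ.1ℤ else ℤ.0ℤ

  δ : (Carrier → Carrier) → Carrier → Carrier → ℤ
  δ F a b = Σ[x] λ x → [ ⌊ F (x + a) + F x ≟ b ⌋ ]

  W : (Carrier → Carrier) → Carrier → Carrier → ℤ
  W F a b = Σ[x] λ x → sgn (b * F x + a * x)

  Subset² : Set
  Subset² = Carrier → Carrier → Bool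

  card : Subset² → ℤ
  card S = Σ[x] λ x → Σ[x] λ y → [ S x y ]

  charSum : Subset² → Carrier → Carrier → ℤ
  charSum S a b = Σ[x] λ x → Σ[x] λ y → if S x y then sgn (a * x + b * y) else ℤ.0ℤ

  diffCount : Subset² → Carrier → Carrier → ℤ
  diffCount S a b =
    Σ[x] λ x → Σ[x] λ y → Σ[x] λ x' → Σ[x] λ y' →
      [ S x y ∧ S x' y' ∧ ⌊ x - x' ≟ a ⌋ ∧ ⌊ y - y' ≟ b ⌋ ]

  -- S is formally self dual under the trace pairing
  -- (the equivalent condition stated in the paper's context)
  FormallySelfDual : Subset² → Set
  FormallySelfDual S =
    ∀ a b → charSum S a b ℤ.* charSum S a b ≡ card S ℤ.* diffCount S a b

  graph : (Carrier → Carrier) → Subset²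
  graph F x y = ⌊ y ≟ F x ⌋

{-# OPTIONS --safe #-}
module Submission where

-- The graph S of F has |S| = 2 ^ n, its character sum at (a, b) is W_F(a, b), and its
-- difference count at (a, b) is the number of x with F x - F (x - a) = b. A field with 2 ^ n
-- elements has characteristic 2 (otherwise negation would be an involution fixing only 0,
-- making 2 ^ n odd), so that count is δ_F(a, b) and the two conditions agree term by term.

open import Defs
open import Data.Nat using (ℕ; _^_)
open import Data.Integer using (ℤ; +_; _*_)
open import Relation.Binary.PropositionalEquality using (_≡_)
open import Function.Bundles using (_⇔_)

open import Algebra.Bundles using (CommutativeMonoid; Ring)
open import Algebra.Structures using (IsCommutativeRing)
import Algebra.Properties.CommutativeMonoid.Sum as MonoidSum
import Algebra.Properties.Group as GroupProperties
open import Data.Bool using (Bool; true; false; if_then_else_; _∧_)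
open import Data.Empty using (⊥; ⊥-elim)
open import Data.Fin using (Fin; zero; suc; punchIn)
open import Data.Fin.Permutation using (permutation)
open import Data.Fin.Properties using (punchInᵢ≢i; _<?_; <-cmp) renaming (_≟_ to _≟ᶠ_)
import Data.Integer as ℤ
import Data.Integer.Properties as ℤ
import Data.Nat as ℕ
import Data.Nat.Properties as ℕ
open import Data.Product using (∃-syntax; _,_; uncurry)
open import Data.Vec.Functional using (Vector; removeAt; replicate)
open import Function using (_∘_; id; Inverse; mk⇔)
open import Relation.Binary.Definitions using (tri<; tri≈; tri>)
open import Relation.Binary.PropositionalEquality
  using (refl; sym; trans; cong; cong₂; _≢_; _≗_; module ≡-Reasoning)
open import Relation.Nullary using (Dec; does; yes; no)
open import Relation.Nullary.Decidable using (⌊_⌋; dec-true; dec-false)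

module _ {c ℓ} (M : CommutativeMonoid c ℓ) where
  open CommutativeMonoid M using (Carrier; _≈_; _∙_; ε; ∙-congˡ; identityʳ; setoid)
  open MonoidSum M using (sum; sum-remove; sum-cong-≋; sum-replicate-zero)
  open import Relation.Binary.Reasoning.Setoid setoid

  sum-supportedAt : ∀ {k} (t : Vector Carrier k) (i : Fin k) →
                    (∀ j → j ≢ i → t j ≈ ε) → sum t ≈ t i
  sum-supportedAt {ℕ.suc k} t i vanish = begin
    sum t                      ≈⟨ sum-remove {i = i} t ⟩
    t i ∙ sum (removeAt t i)   ≈⟨ ∙-congˡ (sum-cong-≋ λ j → vanish (punchIn i j) (punchInᵢ≢i i j)) ⟩
    t i ∙ sum (replicate k ε)  ≈⟨ ∙-congˡ (sum-replicate-zero k) ⟩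
    t i ∙ ε                    ≈⟨ identityʳ (t i) ⟩
    t i                        ∎

𝟙 : ∀ {p} {P : Set p} → Dec P → ℕ
𝟙 P? = if does P? then 1 else 0

𝟙-yes : ∀ {p} {P : Set p} (P? : Dec P) → P → 𝟙 P? ≡ 1
𝟙-yes P? p = cong (λ b → if b then 1 else 0) (dec-true P? p)

𝟙-no : ∀ {p} {P : Set p} (P? : Dec P) → (P → ⊥) → 𝟙 P? ≡ 0
𝟙-no P? ¬p = cong (λ b → if b then 1 else 0) (dec-false P? ¬p)

module ℕSum = MonoidSum ℕ.+-0-commutativeMonoid
module ℤSum = MonoidSum ℤ.+-0-commutativeMonoid

sum-const-1 : ∀ k → ℕSum.sum {k} (λ _ → 1) ≡ k
sum-const-1 ℕ.zero    = refl
sum-const-1 (ℕ.suc k) = cong ℕ.suc (sum-const-1 k)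

module _ {k : ℕ} (π : Fin k → Fin k) (π-involutive : ∀ i → π (π i) ≡ i) where
  open ℕSum using (sum; sum-cong-≗; ∑-distrib-+; sum-permute)
  open ≡-Reasoning

  -- Off its fixed point, π pairs i with π i, and exactly one of the pair is ascending.
  involution-uniqueFixedPoint⇒odd : (j : Fin k) → π j ≡ j → (∀ i → π i ≡ i → i ≡ j) →
                                    ∃[ t ] k ≡ ℕ.suc (2 ℕ.* t)
  involution-uniqueFixedPoint⇒odd j πj≡j fixed⇒j = sum ascent , (begin
    k
      ≡⟨ sum-const-1 k ⟨
    sum {k} (λ _ → 1)
      ≡⟨ sum-cong-≗ classify ⟨
    sum (λ i → ascent i ℕ.+ descent i ℕ.+ fixed i)
      ≡⟨ ∑-distrib-+ (λ i → ascent i ℕ.+ descent i) fixed ⟩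
    sum (λ i → ascent i ℕ.+ descent i) ℕ.+ sum fixed
      ≡⟨ cong₂ ℕ._+_ (∑-distrib-+ ascent descent) fixed-count ⟩
    sum ascent ℕ.+ sum descent ℕ.+ 1
      ≡⟨ cong (λ m → sum ascent ℕ.+ m ℕ.+ 1) descent-count ⟩
    sum ascent ℕ.+ sum ascent ℕ.+ 1
      ≡⟨ ℕ.+-comm (sum ascent ℕ.+ sum ascent) 1 ⟩
    ℕ.suc (sum ascent ℕ.+ sum ascent)
      ≡⟨ cong (λ m → ℕ.suc (sum ascent ℕ.+ m)) (ℕ.+-identityʳ (sum ascent)) ⟨
    ℕ.suc (2 ℕ.* sum ascent)
      ∎)
    where
    ascent descent fixed : Fin k → ℕ
    ascent  i = 𝟙 (i <? π i)
    descent i = 𝟙 (π i <? i)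
    fixed   i = 𝟙 (i ≟ᶠ j)

    moved : ∀ {i} → π i ≢ i → i ≢ j
    moved πi≢i refl = πi≢i πj≡j

    classify : ∀ i → ascent i ℕ.+ descent i ℕ.+ fixed i ≡ 1
    classify i with <-cmp i (π i)
    ... | tri< i<πi i≢πi πi≮i =
      cong₂ ℕ._+_ (cong₂ ℕ._+_ (𝟙-yes (i <? π i) i<πi) (𝟙-no (π i <? i) πi≮i))
                  (𝟙-no (i ≟ᶠ j) (moved (i≢πi ∘ sym)))
    ... | tri≈ i≮πi i≡πi πi≮i =
      cong₂ ℕ._+_ (cong₂ ℕ._+_ (𝟙-no (i <? π i) i≮πi) (𝟙-no (π i <? i) πi≮i))
                  (𝟙-yes (i ≟ᶠ j) (fixed⇒j i (sym i≡πi)))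
    ... | tri> i≮πi i≢πi πi<i =
      cong₂ ℕ._+_ (cong₂ ℕ._+_ (𝟙-no (i <? π i) i≮πi) (𝟙-yes (π i <? i) πi<i))
                  (𝟙-no (i ≟ᶠ j) (moved (i≢πi ∘ sym)))

    fixed-count : sum fixed ≡ 1
    fixed-count = trans (sum-supportedAt ℕ.+-0-commutativeMonoid fixed j (λ i → 𝟙-no (i ≟ᶠ j)))
                        (𝟙-yes (j ≟ᶠ j) refl)

    descent-count : sum descent ≡ sum ascent
    descent-count = sym (trans (sum-permute ascent (permutation π π π-involutive π-involutive))
                               (sum-cong-≗ λ i → cong (λ m → 𝟙 (π i <? m)) (π-involutive i)))

-- The hypothesis i ≢ j only serves to exclude n = 0.
2^n≢odd : ∀ n {i j : Fin (2 ^ n)} → i ≢ j → ∀ t → 2 ^ n ≢ ℕ.suc (2 ℕ.* t)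
2^n≢odd ℕ.zero    {zero} {zero} i≢j = ⊥-elim (i≢j refl)
2^n≢odd (ℕ.suc m) _                 = ℕ.even≢odd (2 ^ m)

module _ {n : ℕ} (K : GF n) where
  open GF K renaming (_*_ to _·_)
  open IsCommutativeRing isCommutativeRing
    using ( +-comm; +-assoc; +-identityˡ; -‿inverseˡ
          ; *-assoc; *-identityʳ; distribˡ; zeroˡ; zeroʳ; isRing)
  open ≡-Reasoning

  private
    ring : Ring _ _
    ring = record { Carrier = Carrier; _≈_ = _≡_; _+_ = _+_; _*_ = _·_; -_ = -_
                  ; 0# = 0#; 1# = 1#; isRing = isRing }

    e : Fin (2 ^ n) → Carrier
    e = Inverse.to enum

    e⁻¹ : Carrier → Fin (2 ^ n)
    e⁻¹ = Inverse.from enum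

    e∘e⁻¹ : ∀ x → e (e⁻¹ x) ≡ x
    e∘e⁻¹ = Inverse.strictlyInverseˡ enum

    e⁻¹∘e : ∀ i → e⁻¹ (e i) ≡ i
    e⁻¹∘e = Inverse.strictlyInverseʳ enum

  open GroupProperties (Ring.+-group ring) using (ε⁻¹≈ε; ⁻¹-involutive; inverseˡ-unique)

  x+x≡x·2 : ∀ x → x + x ≡ x · (1# + 1#)
  x+x≡x·2 x = sym (trans (distribˡ x 1# 1#) (cong₂ _+_ (*-identityʳ x) (*-identityʳ x)))

  x+x≡0⇒x≡0 : 1# + 1# ≢ 0# → ∀ x → x + x ≡ 0# → x ≡ 0#
  x+x≡0⇒x≡0 2≢0 x x+x≡0 with inverse (1# + 1#) 2≢0
  ... | y , 2y≡1 = begin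
    x                     ≡⟨ *-identityʳ x ⟨
    x · 1#                ≡⟨ cong (x ·_) 2y≡1 ⟨
    x · ((1# + 1#) · y)   ≡⟨ *-assoc x (1# + 1#) y ⟨
    (x · (1# + 1#)) · y   ≡⟨ cong (_· y) (trans (sym (x+x≡x·2 x)) x+x≡0) ⟩
    0# · y                ≡⟨ zeroˡ y ⟩
    0#                    ∎

  private
    neg : Fin (2 ^ n) → Fin (2 ^ n)
    neg i = e⁻¹ (- e i)

    neg-involutive : ∀ i → neg (neg i) ≡ i
    neg-involutive i =
      trans (cong e⁻¹ (trans (cong -_ (e∘e⁻¹ (- e i))) (⁻¹-involutive (e i)))) (e⁻¹∘e i)

    neg-0 : neg (e⁻¹ 0#) ≡ e⁻¹ 0#
    neg-0 = cong e⁻¹ (trans (cong -_ (e∘e⁻¹ 0#)) ε⁻¹≈ε)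

    neg-fixed⇒0 : 1# + 1# ≢ 0# → ∀ i → neg i ≡ i → i ≡ e⁻¹ 0#
    neg-fixed⇒0 2≢0 i neg-i≡i = begin
      i            ≡⟨ e⁻¹∘e i ⟨
      e⁻¹ (e i)    ≡⟨ cong e⁻¹ (x+x≡0⇒x≡0 2≢0 (e i) ei+ei≡0) ⟩
      e⁻¹ 0#       ∎
      where
      -ei≡ei : - e i ≡ e i
      -ei≡ei = trans (sym (e∘e⁻¹ (- e i))) (cong e neg-i≡i)

      ei+ei≡0 : e i + e i ≡ 0#
      ei+ei≡0 = trans (cong (_+ e i) (sym -ei≡ei)) (-‿inverseˡ (e i))

    e⁻¹0≢e⁻¹1 : e⁻¹ 0# ≢ e⁻¹ 1#
    e⁻¹0≢e⁻¹1 eq = 0≢1 (trans (sym (e∘e⁻¹ 0#)) (trans (cong e eq) (e∘e⁻¹ 1#)))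

  1+1≡0 : 1# + 1# ≡ 0#
  1+1≡0 with 1# + 1# ≟ 0#
  ... | yes 2≡0 = 2≡0
  ... | no  2≢0 = ⊥-elim (uncurry (2^n≢odd n e⁻¹0≢e⁻¹1) 2^n-odd)
    where
    2^n-odd : ∃[ t ] 2 ^ n ≡ ℕ.suc (2 ℕ.* t)
    2^n-odd = involution-uniqueFixedPoint⇒odd neg neg-involutive (e⁻¹ 0#) neg-0 (neg-fixed⇒0 2≢0)

  x+x≡0 : ∀ x → x + x ≡ 0#
  x+x≡0 x = trans (x+x≡x·2 x) (trans (cong (x ·_) 1+1≡0) (zeroʳ x))

  -x≡x : ∀ x → - x ≡ x
  -x≡x x = sym (inverseˡ-unique x x (x+x≡0 x))

  x-y≡x+y : ∀ x y → x - y ≡ x + y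
  x-y≡x+y x y = cong (λ z → x + z) (-x≡x y)

  x+[x+y]≡y : ∀ x y → x + (x + y) ≡ y
  x+[x+y]≡y x y = begin
    x + (x + y)  ≡⟨ +-assoc x x y ⟨
    (x + x) + y  ≡⟨ cong (_+ y) (x+x≡0 x) ⟩
    0# + y       ≡⟨ +-identityˡ y ⟩
    y            ∎

  x-y≡a⇒y≡x+a : ∀ {x y a} → x - y ≡ a → y ≡ x + a
  x-y≡a⇒y≡x+a {x} {y} {a} x-y≡a = begin
    y            ≡⟨ x+[x+y]≡y x y ⟨
    x + (x + y)  ≡⟨ cong (λ z → x + z) (trans (sym (x-y≡x+y x y)) x-y≡a) ⟩
    x + a        ∎

  x-[x+a]≡a : ∀ x a → x - (x + a) ≡ a
  x-[x+a]≡a x a = trans (x-y≡x+y x (x + a)) (x+[x+y]≡y x a)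

  open ℤSum using (sum; sum-cong-≗; sum-replicate-zero)

  Σ≡sum : ∀ f → Σ[x] f ≡ sum (f ∘ e)
  Σ≡sum f = sumFin≡sum (2 ^ n) (f ∘ e)
    where
    sumFin≡sum : ∀ k (g : Fin k → ℤ) → sumFin k g ≡ sum g
    sumFin≡sum ℕ.zero    g = refl
    sumFin≡sum (ℕ.suc k) g = cong (λ m → g zero ℤ.+ m) (sumFin≡sum k (g ∘ suc))

  Σ-cong : ∀ {f g : Carrier → ℤ} → f ≗ g → Σ[x] f ≡ Σ[x] g
  Σ-cong {f} {g} f≗g = trans (Σ≡sum f) (trans (sum-cong-≗ (f≗g ∘ e)) (sym (Σ≡sum g)))

  Σ-zero : Σ[x] (λ _ → ℤ.0ℤ) ≡ ℤ.0ℤ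
  Σ-zero = trans (Σ≡sum _) (sum-replicate-zero (2 ^ n))

  Σ-one : Σ[x] (λ _ → ℤ.1ℤ) ≡ + (2 ^ n)
  Σ-one = sumFin-one (2 ^ n)
    where
    sumFin-one : ∀ k → sumFin k (λ _ → ℤ.1ℤ) ≡ + k
    sumFin-one ℕ.zero    = refl
    sumFin-one (ℕ.suc k) = cong (λ m → ℤ.1ℤ ℤ.+ m) (sumFin-one k)

  Σ-supportedAt : ∀ (g : Carrier → ℤ) c → (∀ x → x ≢ c → g x ≡ ℤ.0ℤ) → Σ[x] g ≡ g c
  Σ-supportedAt g c vanish = begin
    Σ[x] g           ≡⟨ Σ≡sum g ⟩
    sum (g ∘ e)      ≡⟨ sum-supportedAt ℤ.+-0-commutativeMonoid (g ∘ e) (e⁻¹ c) vanish∘e ⟩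
    g (e (e⁻¹ c))    ≡⟨ cong g (e∘e⁻¹ c) ⟩
    g c              ∎
    where
    vanish∘e : ∀ i → i ≢ e⁻¹ c → g (e i) ≡ ℤ.0ℤ
    vanish∘e i i≢ = vanish (e i) λ ei≡c → i≢ (trans (sym (e⁻¹∘e i)) (cong e⁻¹ ei≡c))

  Σ-select : ∀ (f : Carrier → Carrier) a {c} (g : Carrier → ℤ) →
             (∀ y → f y ≡ a → y ≡ c) → f c ≡ a →
             Σ[x] (λ y → if ⌊ f y ≟ a ⌋ then g y else ℤ.0ℤ) ≡ g c
  Σ-select f a {c} g unique fc≡a = trans (Σ-supportedAt _ c vanish) selected
    where
    vanish : ∀ y → y ≢ c → (if ⌊ f y ≟ a ⌋ then g y else ℤ.0ℤ) ≡ ℤ.0ℤ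
    vanish y y≢c with f y ≟ a
    ... | yes fy≡a = ⊥-elim (y≢c (unique y fy≡a))
    ... | no  _    = refl

    selected : (if ⌊ f c ≟ a ⌋ then g c else ℤ.0ℤ) ≡ g c
    selected with f c ≟ a
    ... | yes _    = refl
    ... | no  fc≢a = ⊥-elim (fc≢a fc≡a)

  [∧]≡if : ∀ p q → [ p ∧ q ] ≡ (if p then [ q ] else ℤ.0ℤ)
  [∧]≡if true  q = refl
  [∧]≡if false q = refl

  Σ-select-∧ : ∀ (f : Carrier → Carrier) a {c} (q : Carrier → Bool) →
               (∀ y → f y ≡ a → y ≡ c) → f c ≡ a →
               Σ[x] (λ y → [ ⌊ f y ≟ a ⌋ ∧ q y ]) ≡ [ q c ]
  Σ-select-∧ f a q unique fc≡a =
    trans (Σ-cong λ y → [∧]≡if ⌊ f y ≟ a ⌋ (q y)) (Σ-select f a (λ y → [ q y ]) unique fc≡a)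

  ΣΣ-[∧] : ∀ p (r : Carrier → Carrier → Bool) →
           (Σ[x] λ x → Σ[x] λ y → [ p ∧ r x y ])
             ≡ (if p then (Σ[x] λ x → Σ[x] λ y → [ r x y ]) else ℤ.0ℤ)
  ΣΣ-[∧] true  r = refl
  ΣΣ-[∧] false r = trans (Σ-cong λ _ → Σ-zero) Σ-zero

  module _ (F : Carrier → Carrier) where

    charSum-graph : ∀ a b → charSum (graph F) a b ≡ W F a b
    charSum-graph a b = Σ-cong λ x →
      trans (Σ-select id (F x) (λ y → sgn (a · x + b · y)) (λ _ → id) refl)
            (cong sgn (+-comm (a · x) (b · F x)))

    card-graph : card (graph F) ≡ + (2 ^ n)
    card-graph = trans (Σ-cong λ x → Σ-select id (F x) (λ _ → ℤ.1ℤ) (λ _ → id) refl) Σ-one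

    diffCount-graph : ∀ a b → diffCount (graph F) a b ≡ δ F a b
    diffCount-graph a b = Σ-cong row
      where
      row : ∀ x → (Σ[x] λ y → Σ[x] λ x' → Σ[x] λ y' →
                     [ ⌊ y ≟ F x ⌋ ∧ ⌊ y' ≟ F x' ⌋ ∧ ⌊ x - x' ≟ a ⌋ ∧ ⌊ y - y' ≟ b ⌋ ])
                  ≡ [ ⌊ F (x + a) + F x ≟ b ⌋ ]
      row x = begin
        (Σ[x] λ y → Σ[x] λ x' → Σ[x] λ y' → [ ⌊ y ≟ F x ⌋ ∧ ⌊ y' ≟ F x' ⌋ ∧ difference y x' y' ])
          ≡⟨ Σ-cong (λ y → ΣΣ-[∧] ⌊ y ≟ F x ⌋ λ x' y' → ⌊ y' ≟ F x' ⌋ ∧ difference y x' y') ⟩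
        (Σ[x] λ y → if ⌊ y ≟ F x ⌋
                      then (Σ[x] λ x' → Σ[x] λ y' → [ ⌊ y' ≟ F x' ⌋ ∧ difference y x' y' ])
                      else ℤ.0ℤ)
          ≡⟨ Σ-select id (F x)
               (λ y → Σ[x] λ x' → Σ[x] λ y' → [ ⌊ y' ≟ F x' ⌋ ∧ difference y x' y' ])
               (λ _ → id) refl ⟩
        (Σ[x] λ x' → Σ[x] λ y' → [ ⌊ y' ≟ F x' ⌋ ∧ difference (F x) x' y' ])
          ≡⟨ Σ-cong (λ x' → Σ-select-∧ id (F x') (difference (F x) x') (λ _ → id) refl) ⟩
        (Σ[x] λ x' → [ ⌊ x - x' ≟ a ⌋ ∧ ⌊ F x - F x' ≟ b ⌋ ])
          ≡⟨ Σ-select-∧ (λ x' → x - x') a (λ x' → ⌊ F x - F x' ≟ b ⌋)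
                       (λ _ → x-y≡a⇒y≡x+a) (x-[x+a]≡a x a) ⟩
        [ ⌊ F x - F (x + a) ≟ b ⌋ ]
          ≡⟨ cong (λ z → [ ⌊ z ≟ b ⌋ ])
                  (trans (x-y≡x+y (F x) (F (x + a))) (+-comm (F x) (F (x + a)))) ⟩
        [ ⌊ F (x + a) + F x ≟ b ⌋ ] ∎
        where
        difference : Carrier → Carrier → Carrier → Bool
        difference y x' y' = ⌊ x - x' ≟ a ⌋ ∧ ⌊ y - y' ≟ b ⌋

theorem6p3 : (n : ℕ) (K : GF n) (F : GF.Carrier K → GF.Carrier K) →
    GF.FormallySelfDual K (GF.graph K F) ⇔
      (∀ a b → (+ (2 ^ n)) * GF.δ K F a b ≡ GF.W K F a b * GF.W K F a b)
theorem6p3 n K F = mk⇔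
  (λ selfDual a b → trans (2ⁿδ≡card·diffCount a b) (trans (sym (selfDual a b)) (charSum²≡W² a b)))
  (λ 2ⁿδ≡W² a b → trans (charSum²≡W² a b) (trans (sym (2ⁿδ≡W² a b)) (2ⁿδ≡card·diffCount a b)))
  where
  open GF K using (δ; W; card; diffCount; charSum; graph)

  charSum²≡W² : ∀ a b → charSum (graph F) a b * charSum (graph F) a b ≡ W F a b * W F a b
  charSum²≡W² a b = cong₂ _*_ (charSum-graph K F a b) (charSum-graph K F a b)

  2ⁿδ≡card·diffCount : ∀ a b → + (2 ^ n) * δ F a b ≡ card (graph F) * diffCount (graph F) a b
  2ⁿδ≡card·diffCount a b = sym (cong₂ _*_ (card-graph K F) (diffCount-graph K F a b))
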